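{- Let $\mathcal M=(M,\mathit{TRUE},f_\bot,f_\top,f_\vee,f_\wedge,f_\rightarrow,f_\square,f_K)$ be a Heyting algebra with a designated ultrafilter $\mathit{TRUE}$ and additional unary operations $f_\square,f_K$ (with $\mathit{BEL}$ taken to be $\{m\in M: f_K(m)\in\mathit{TRUE}\}$). Then $\mathcal M$ is an $EL5^-$-model if and only if for all $m,m'\in M$: (a) $\mathcal M$ has the Disjunction Property: $f_\vee(m,m')=f_\top$ iff $m=f_\top$ or $m'=f_\top$; (b) $f_\square(m)=f_\top$ if $m=f_\top$, and $f_\square(m)=f_\bot$ otherwise; (c) $f_K(f_\rightarrow(m,m'))\le f_\rightarrow(f_K(m),f_K(m'))$; (d) $f_K(f_\top)=f_\top$. Moreover, $\mathcal M$ is an $EL5$-model if and only if (a)–(d) hold and in addition (e) $f_K(m)\le f_\neg(f_\neg(m))$ for all $m\in M$.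
   Context: Heyting algebra notation: bottom $f_\bot$, top $f_\top$, join $f_\vee$, meet $f_\wedge$, relative pseudo-complement $f_\rightarrow$, order $\le$, $f_\neg(m):=f_\rightarrow(m,f_\bot)$. An ultrafilter is a maximal proper filter. An $EL3^-$-model is such a Heyting algebra with a designated ultrafilter $\mathit{TRUE}\subseteq M$, a set $\mathit{BEL}\subseteq M$ and unary operations $f_\square,f_K$ such that for all $m,m'\in M$: (i) $f_\square(f_\vee(m,m'))\le f_\vee(f_\square(m),f_\square(m'))$; (ii) $f_\square(m)\le m$; (iii) $f_\square(f_\rightarrow(m,m'))\le f_\square(f_\rightarrow(f_\square(m),f_\square(m')))$; (iv) $f_\square(m)\in\mathit{TRUE}\iff m=f_\top$; (v) $f_K(m)\in\mathit{TRUE}\iff m\in\mathit{BEL}$; (vi) $f_K(f_\rightarrow(m,m'))\le f_\rightarrow(f_K(m),f_K(m'))$; (vii) $f_\square(m)\le f_\square(f_K(m))$. An $EL5^-$-model is an $EL3^-$-model with $f_\square(m)=f_\top$ if $m=f_\top$ and $f_\square(m)=f_\bot$ otherwise. An $EL5$-model is an $EL5^-$-model with $f_K(m)\le f_\neg(f_\neg(m))$ for all $m$. -}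

module Defs where

open import Level using (Level; _⊔_) renaming (suc to lsuc)
open import Data.Product using (_×_; _,_)
open import Data.Sum using (_⊎_)
open import Relation.Nullary using (¬_)
open import Relation.Unary using (Pred; _∈_; _∉_; _⊆_)
open import Relation.Binary.Lattice.Bundles using (HeytingAlgebra)
open import Function.Bundles using (_⇔_)

module _ {ℓ : Level} (H : HeytingAlgebra ℓ ℓ ℓ) where
  open HeytingAlgebra H

  neg : Carrier → Carrier
  neg m = m ⇨ ⊥

  record IsFilter (F : Pred Carrier ℓ) : Set ℓ where
    field
      top∈    : ⊤ ∈ F
      up      : ∀ {x y} → x ≤ y → x ∈ F → y ∈ F
      meet∈   : ∀ {x y} → x ∈ F → y ∈ F → (x ∧ y) ∈ F

  record IsProperFilter (F : Pred Carrier ℓ) : Set ℓ where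
    field
      isFilter : IsFilter F
      proper   : ⊥ ∉ F

  record IsUltrafilter (F : Pred Carrier ℓ) : Set (lsuc ℓ) where
    field
      isProperFilter : IsProperFilter F
      maximal        : (G : Pred Carrier ℓ) → IsProperFilter G → F ⊆ G → G ⊆ F

  -- The data of the structure M = (M, TRUE, f⊥, f⊤, f∨, f∧, f→, f□, fK):
  -- H supplies (M, f⊥, f⊤, f∨, f∧, f→); TRUE is a designated ultrafilter;
  -- f□ and fK are unary operations on M (required to respect the
  -- underlying equality ≈, since M is a set in the paper).
  module _ (TRUE : Pred Carrier ℓ) (f□ fK : Carrier → Carrier) where

    record IsEL3⁻ (BEL : Pred Carrier ℓ) : Set ℓ where
      field
        c-i   : ∀ m m' → f□ (m ∨ m') ≤ (f□ m ∨ f□ m')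
        c-ii  : ∀ m → f□ m ≤ m
        c-iii : ∀ m m' → f□ (m ⇨ m') ≤ f□ (f□ m ⇨ f□ m')
        c-iv  : ∀ m → (f□ m ∈ TRUE) ⇔ (m ≈ ⊤)
        c-v   : ∀ m → (fK m ∈ TRUE) ⇔ (m ∈ BEL)
        c-vi  : ∀ m m' → fK (m ⇨ m') ≤ (fK m ⇨ fK m')
        c-vii : ∀ m → f□ m ≤ f□ (fK m)

    TopTest : Set ℓ
    TopTest = ∀ m → (m ≈ ⊤ → f□ m ≈ ⊤) × (¬ (m ≈ ⊤) → f□ m ≈ ⊥)

    record IsEL5⁻ (BEL : Pred Carrier ℓ) : Set ℓ where
      field
        isEL3⁻  : IsEL3⁻ BEL
        topTest : TopTest

    record IsEL5 (BEL : Pred Carrier ℓ) : Set ℓ where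
      field
        isEL5⁻ : IsEL5⁻ BEL
        kneg   : ∀ m → fK m ≤ neg (neg m)

    BELof : Pred Carrier ℓ
    BELof m = fK m ∈ TRUE

    DisjunctionProperty : Set ℓ
    DisjunctionProperty = ∀ m m' → ((m ∨ m') ≈ ⊤) ⇔ (m ≈ ⊤ ⊎ m' ≈ ⊤)

    Conds-a-d : Set ℓ
    Conds-a-d = DisjunctionProperty
              × TopTest
              × (∀ m m' → fK (m ⇨ m') ≤ (fK m ⇨ fK m'))
              × (fK ⊤ ≈ ⊤)

    Cond-e : Set ℓ
    Cond-e = ∀ m → fK m ≤ neg (neg m)

-- With excluded middle, a top-test f□ takes only the values ⊤ (at ⊤) and ⊥, so
-- each inequality f□ m ≤ y reduces to "m = ⊤ forces y = ⊤". Read this way, (i)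
-- is the Disjunction Property (using ⊤ ≠ ⊥), (ii) and (iii) hold outright, (iv)
-- holds as TRUE is proper, and (vii) amounts to fK ⊤ = ⊤; (v) holds by the
-- choice of BEL and (vi) is (c).
module Submission where

open import Defs
open import Level using (Level)
open import Data.Product using (_×_; _,_; proj₁; proj₂)
open import Data.Sum using (_⊎_; inj₁; inj₂)
open import Data.Empty using (⊥-elim)
open import Relation.Nullary using (¬_; yes; no)
open import Relation.Unary using (Pred; _∈_)
open import Relation.Binary.Lattice.Bundles using (HeytingAlgebra)
open import Function.Base using (id)
open import Function.Bundles using (_⇔_; mk⇔; Equivalence)
open import Axiom.ExcludedMiddle using (ExcludedMiddle)
import Relation.Binary.Lattice.Properties.HeytingAlgebra as HeytingAlgebraProperties

module _ {ℓ : Level} (H : HeytingAlgebra ℓ ℓ ℓ) where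
  open HeytingAlgebra H
  open HeytingAlgebraProperties H using (⇨-applyʳ; swap-transpose-⇨)

  ⊤≤⇒≈⊤ : ∀ {x} → ⊤ ≤ x → x ≈ ⊤
  ⊤≤⇒≈⊤ = antisym (maximum _)

  ≈⊤⇒⊤≤ : ∀ {x} → x ≈ ⊤ → ⊤ ≤ x
  ≈⊤⇒⊤≤ e = reflexive (Eq.sym e)

  ≈⊥⇒≤ : ∀ {x y} → x ≈ ⊥ → x ≤ y
  ≈⊥⇒≤ e = trans (reflexive e) (minimum _)

  ≤⇒⇨≈⊤ : ∀ {x y} → x ≤ y → (x ⇨ y) ≈ ⊤
  ≤⇒⇨≈⊤ x≤y = ⊤≤⇒≈⊤ (swap-transpose-⇨ (trans (x∧y≤x _ _) x≤y))

  ⇨≈⊤⇒≤ : ∀ {x y} → (x ⇨ y) ≈ ⊤ → x ≤ y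
  ⇨≈⊤⇒≤ e = trans (∧-greatest refl (trans (maximum _) (≈⊤⇒⊤≤ e))) (⇨-applyʳ refl)

  ≈⊤⊎≈⊤⇒∨≈⊤ : ∀ {x y} → x ≈ ⊤ ⊎ y ≈ ⊤ → (x ∨ y) ≈ ⊤
  ≈⊤⊎≈⊤⇒∨≈⊤ (inj₁ x≈⊤) = ⊤≤⇒≈⊤ (trans (≈⊤⇒⊤≤ x≈⊤) (x≤x∨y _ _))
  ≈⊤⊎≈⊤⇒∨≈⊤ (inj₂ y≈⊤) = ⊤≤⇒≈⊤ (trans (≈⊤⇒⊤≤ y≈⊤) (y≤x∨y _ _))

  module _ {F : Pred Carrier ℓ} (F-proper : IsProperFilter H F) where
    open IsProperFilter F-proper
    open IsFilter isFilter

    ≈⊤⇒∈ : ∀ {x} → x ≈ ⊤ → x ∈ F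
    ≈⊤⇒∈ e = up (≈⊤⇒⊤≤ e) top∈

    ≈⊥⇒∉ : ∀ {x} → x ≈ ⊥ → ¬ (x ∈ F)
    ≈⊥⇒∉ e x∈F = proper (up (reflexive e) x∈F)

    ⊤≰⊥ : ¬ (⊤ ≤ ⊥)
    ⊤≰⊥ ⊤≤⊥ = proper (up ⊤≤⊥ top∈)

  module TopTestProperties (em : ExcludedMiddle ℓ) (f□ : Carrier → Carrier)
    (topTest : ∀ m → (m ≈ ⊤ → f□ m ≈ ⊤) × (¬ (m ≈ ⊤) → f□ m ≈ ⊥)) where

    □-⊤ : ∀ {m} → m ≈ ⊤ → f□ m ≈ ⊤
    □-⊤ {m} = proj₁ (topTest m)

    □-⊥ : ∀ {m} → ¬ (m ≈ ⊤) → f□ m ≈ ⊥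
    □-⊥ {m} = proj₂ (topTest m)

    □-≤ : ∀ {m y} → (m ≈ ⊤ → ⊤ ≤ y) → f□ m ≤ y
    □-≤ {m} ⊤⇒⊤≤y with em {m ≈ ⊤}
    ... | yes m≈⊤ = trans (reflexive (□-⊤ m≈⊤)) (⊤⇒⊤≤y m≈⊤)
    ... | no  m≉⊤ = ≈⊥⇒≤ (□-⊥ m≉⊤)

    □-deflationary : ∀ m → f□ m ≤ m
    □-deflationary m = □-≤ ≈⊤⇒⊤≤

    □-mono : ∀ {m m'} → m ≤ m' → f□ m ≤ f□ m'
    □-mono m≤m' = □-≤ λ m≈⊤ → ≈⊤⇒⊤≤ (□-⊤ (⊤≤⇒≈⊤ (trans (≈⊤⇒⊤≤ m≈⊤) m≤m')))

    □-⇨ : ∀ m m' → f□ (m ⇨ m') ≤ f□ (f□ m ⇨ f□ m')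
    □-⇨ m m' = □-≤ λ e → ≈⊤⇒⊤≤ (□-⊤ (≤⇒⇨≈⊤ (□-mono (⇨≈⊤⇒≤ e))))

    □-∈⇔≈⊤ : {F : Pred Carrier ℓ} → IsProperFilter H F → ∀ m → (f□ m ∈ F) ⇔ (m ≈ ⊤)
    □-∈⇔≈⊤ {F} F-proper m = mk⇔ to (λ m≈⊤ → ≈⊤⇒∈ F-proper (□-⊤ m≈⊤))
      where
      to : f□ m ∈ F → m ≈ ⊤
      to □m∈F with em {m ≈ ⊤}
      ... | yes m≈⊤ = m≈⊤
      ... | no  m≉⊤ = ⊥-elim (≈⊥⇒∉ F-proper (□-⊥ m≉⊤) □m∈F)

    □-∨ : (∀ m m' → (m ∨ m') ≈ ⊤ → m ≈ ⊤ ⊎ m' ≈ ⊤) → ∀ m m' → f□ (m ∨ m') ≤ (f□ m ∨ f□ m')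
    □-∨ disj m m' = □-≤ λ e → case (disj m m' e)
      where
      case : m ≈ ⊤ ⊎ m' ≈ ⊤ → ⊤ ≤ (f□ m ∨ f□ m')
      case (inj₁ m≈⊤)  = trans (≈⊤⇒⊤≤ (□-⊤ m≈⊤)) (x≤x∨y _ _)
      case (inj₂ m'≈⊤) = trans (≈⊤⇒⊤≤ (□-⊤ m'≈⊤)) (y≤x∨y _ _)

    □-∨⇒disjunction : ¬ (⊤ ≤ ⊥) → (∀ m m' → f□ (m ∨ m') ≤ (f□ m ∨ f□ m'))
      → ∀ m m' → ((m ∨ m') ≈ ⊤) ⇔ (m ≈ ⊤ ⊎ m' ≈ ⊤)
    □-∨⇒disjunction ⊤≰⊥ □∨ m m' = mk⇔ to ≈⊤⊎≈⊤⇒∨≈⊤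
      where
      to : (m ∨ m') ≈ ⊤ → m ≈ ⊤ ⊎ m' ≈ ⊤
      to e with em {m ≈ ⊤} | em {m' ≈ ⊤}
      ... | yes m≈⊤ | _        = inj₁ m≈⊤
      ... | no _    | yes m'≈⊤ = inj₂ m'≈⊤
      ... | no m≉⊤  | no m'≉⊤  = ⊥-elim (⊤≰⊥ (trans (≈⊤⇒⊤≤ (□-⊤ e))
        (trans (□∨ m m') (∨-least (≈⊥⇒≤ (□-⊥ m≉⊤)) (≈⊥⇒≤ (□-⊥ m'≉⊤))))))

    □-≤-□∘K : (fK : Carrier → Carrier) → (∀ {x y} → x ≈ y → fK x ≈ fK y) → fK ⊤ ≈ ⊤
      → ∀ m → f□ m ≤ f□ (fK m)
    □-≤-□∘K fK fK-cong K⊤ m = □-≤ λ m≈⊤ → ≈⊤⇒⊤≤ (□-⊤ (Eq.trans (fK-cong m≈⊤) K⊤))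

    K⊤≈⊤ : (fK : Carrier → Carrier) → (∀ m → f□ m ≤ f□ (fK m)) → fK ⊤ ≈ ⊤
    K⊤≈⊤ fK □≤□K = ⊤≤⇒≈⊤ (trans (≈⊤⇒⊤≤ (□-⊤ Eq.refl)) (trans (□≤□K ⊤) (□-deflationary _)))

module _ {ℓ : Level} (em : ExcludedMiddle ℓ) (H : HeytingAlgebra ℓ ℓ ℓ)
  {TRUE : Pred (HeytingAlgebra.Carrier H) ℓ} (TRUE-proper : IsProperFilter H TRUE)
  {f□ fK : HeytingAlgebra.Carrier H → HeytingAlgebra.Carrier H}
  (fK-cong : ∀ {x y} → HeytingAlgebra._≈_ H x y → HeytingAlgebra._≈_ H (fK x) (fK y)) where

  EL5⁻⇔Conds-a-d : IsEL5⁻ H TRUE f□ fK (BELof H TRUE f□ fK) ⇔ Conds-a-d H TRUE f□ fK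
  EL5⁻⇔Conds-a-d = mk⇔ to from
    where
    to : IsEL5⁻ H TRUE f□ fK (BELof H TRUE f□ fK) → Conds-a-d H TRUE f□ fK
    to record { isEL3⁻ = el3 ; topTest = topTest } =
      □-∨⇒disjunction (⊤≰⊥ H TRUE-proper) c-i , topTest , c-vi , K⊤≈⊤ fK c-vii
      where
      open IsEL3⁻ el3
      open TopTestProperties H em f□ topTest

    from : Conds-a-d H TRUE f□ fK → IsEL5⁻ H TRUE f□ fK (BELof H TRUE f□ fK)
    from (disjunction , topTest , K-⇨ , K⊤) = record
      { isEL3⁻ = record
        { c-i   = □-∨ (λ m m' → Equivalence.to (disjunction m m'))
        ; c-ii  = □-deflationary
        ; c-iii = □-⇨
        ; c-iv  = □-∈⇔≈⊤ TRUE-proper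
        ; c-v   = λ _ → mk⇔ id id
        ; c-vi  = K-⇨
        ; c-vii = □-≤-□∘K fK fK-cong K⊤ }
      ; topTest = topTest }
      where open TopTestProperties H em f□ topTest

lemma3p13 : {ℓ : Level} → ExcludedMiddle ℓ → (H : HeytingAlgebra ℓ ℓ ℓ)
    → (TRUE : Pred (HeytingAlgebra.Carrier H) ℓ) → IsUltrafilter H TRUE
    → (f□ fK : HeytingAlgebra.Carrier H → HeytingAlgebra.Carrier H)
    → (∀ {x y} → HeytingAlgebra._≈_ H x y → HeytingAlgebra._≈_ H (f□ x) (f□ y))
    → (∀ {x y} → HeytingAlgebra._≈_ H x y → HeytingAlgebra._≈_ H (fK x) (fK y))
    → (IsEL5⁻ H TRUE f□ fK (BELof H TRUE f□ fK) ⇔ Conds-a-d H TRUE f□ fK)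
    × (IsEL5 H TRUE f□ fK (BELof H TRUE f□ fK) ⇔ (Conds-a-d H TRUE f□ fK × Cond-e H TRUE f□ fK))
lemma3p13 em H TRUE TRUE-ultra f□ fK _ fK-cong =
  el5⁻⇔ ,
  mk⇔ (λ el5 → Equivalence.to el5⁻⇔ (IsEL5.isEL5⁻ el5) , IsEL5.kneg el5)
      (λ (conds , kneg) → record { isEL5⁻ = Equivalence.from el5⁻⇔ conds ; kneg = kneg })
  where
  el5⁻⇔ : IsEL5⁻ H TRUE f□ fK (BELof H TRUE f□ fK) ⇔ Conds-a-d H TRUE f□ fK
  el5⁻⇔ = EL5⁻⇔Conds-a-d em H (IsUltrafilter.isProperFilter TRUE-ultra) fK-cong
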